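{- Let $G$ be a group, let $L,R$ be nonempty subsets of $G$, let $N$ be a normal subgroup of $G$, and let $\phi:G\to G/N$ be the canonical projection. Then $2\mathrm{S}(G;L,R)$ is weakly connected if and only if $2\mathrm{S}(G/N;\phi(L),\phi(R))$ is weakly connected and $N$ is weakly connected within $2\mathrm{S}(G;L,R)$.
   Context: For a group $G$ and nonempty subsets $L,R\subseteq G$, the two-sided group digraph $2\mathrm{S}(G;L,R)$ has vertex set $G$ and a directed arc $(g,h)$ if and only if $h=l^{ -1}gr$ for some $l\in L$, $r\in R$. Vertex $g$ is weakly connected to $h$ if there is a sequence $g=g_0,\dots,g_n=h$ such that for each $i$ either $(g_{i-1},g_i)$ or $(g_i,g_{i-1})$ is an arc; a digraph is weakly connected if every pair of its vertices is weakly connected. A subset $H\subseteq G$ is weakly connected within $2\mathrm{S}(G;L,R)$ if every two elements of $H$ are weakly connected in $2\mathrm{S}(G;L,R)$ (connecting paths may leave $H$). -}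

module Defs where

open import Level using (Level; _⊔_)
open import Algebra.Bundles using (Group)
open import Algebra.Structures using (IsGroup)
open import Data.Product using (_×_; _,_; ∃; ∃₂)
open import Relation.Unary using (Pred)
open import Relation.Binary.Structures using (IsEquivalence)
import Algebra.Properties.Group as GP
import Relation.Binary.Reasoning.Setoid as SetoidReasoning

private
  variable
    c ℓ ℓN ℓL ℓR ℓH : Level

record IsNormalSubgroup (G : Group c ℓ) (N : Pred (Group.Carrier G) ℓN)
       : Set (c ⊔ ℓ ⊔ ℓN) where
  open Group G
  field
    resp     : ∀ {x y} → x ≈ y → N x → N y
    ε∈       : N ε
    ∙-closed : ∀ {x y} → N x → N y → N (x ∙ y)
    ⁻¹-closed : ∀ {x} → N x → N (x ⁻¹)
    normal   : ∀ g {n} → N n → N (g ⁻¹ ∙ n ∙ g)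

-- Its elements are represented by elements of
-- G, two representatives being equal iff they lie in the same coset
-- (x ~ y  iff  x⁻¹ y ∈ N).  The canonical projection φ : G → G/N is
-- then the identity on representatives.

module _ (G : Group c ℓ) {N : Pred (Group.Carrier G) ℓN}
         (isN : IsNormalSubgroup G N) where
  open Group G
  open IsNormalSubgroup isN
  open GP G using (⁻¹-anti-homo-∙)
  open SetoidReasoning setoid

  _~_ : Carrier → Carrier → Set ℓN
  x ~ y = N (x ⁻¹ ∙ y)

  private
    lift : ∀ {x y} → x ≈ y → x ~ y
    lift {x} {y} x≈y = resp (begin
      ε           ≈⟨ sym (inverseˡ x) ⟩
      x ⁻¹ ∙ x    ≈⟨ ∙-congˡ x≈y ⟩
      x ⁻¹ ∙ y    ∎) ε∈

    ~-sym : ∀ {x y} → x ~ y → y ~ x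
    ~-sym {x} {y} p = resp (begin
      (x ⁻¹ ∙ y) ⁻¹     ≈⟨ ⁻¹-anti-homo-∙ (x ⁻¹) y ⟩
      y ⁻¹ ∙ x ⁻¹ ⁻¹    ≈⟨ ∙-congˡ (GP.⁻¹-involutive G x) ⟩
      y ⁻¹ ∙ x          ∎) (⁻¹-closed p)

    ~-trans : ∀ {x y z} → x ~ y → y ~ z → x ~ z
    ~-trans {x} {y} {z} p q = resp (begin
      x ⁻¹ ∙ y ∙ (y ⁻¹ ∙ z)    ≈⟨ assoc (x ⁻¹) y (y ⁻¹ ∙ z) ⟩
      x ⁻¹ ∙ (y ∙ (y ⁻¹ ∙ z))  ≈⟨ ∙-congˡ (sym (assoc y (y ⁻¹) z)) ⟩
      x ⁻¹ ∙ (y ∙ y ⁻¹ ∙ z)    ≈⟨ ∙-congˡ (∙-congʳ (inverseʳ y)) ⟩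
      x ⁻¹ ∙ (ε ∙ z)           ≈⟨ ∙-congˡ (identityˡ z) ⟩
      x ⁻¹ ∙ z                 ∎) (∙-closed p q)

    ~-∙-cong : ∀ {x x' y y'} → x ~ x' → y ~ y' → (x ∙ y) ~ (x' ∙ y')
    ~-∙-cong {x} {x'} {y} {y'} p q = resp (begin
      y ⁻¹ ∙ a ∙ y ∙ (y ⁻¹ ∙ y')     ≈⟨ assoc (y ⁻¹ ∙ a) y (y ⁻¹ ∙ y') ⟩
      y ⁻¹ ∙ a ∙ (y ∙ (y ⁻¹ ∙ y'))   ≈⟨ ∙-congˡ (sym (assoc y (y ⁻¹) y')) ⟩
      y ⁻¹ ∙ a ∙ (y ∙ y ⁻¹ ∙ y')     ≈⟨ ∙-congˡ (∙-congʳ (inverseʳ y)) ⟩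
      y ⁻¹ ∙ a ∙ (ε ∙ y')            ≈⟨ ∙-congˡ (identityˡ y') ⟩
      y ⁻¹ ∙ a ∙ y'                  ≈⟨ assoc (y ⁻¹) a y' ⟩
      y ⁻¹ ∙ (x ⁻¹ ∙ x' ∙ y')        ≈⟨ ∙-congˡ (assoc (x ⁻¹) x' y') ⟩
      y ⁻¹ ∙ (x ⁻¹ ∙ (x' ∙ y'))      ≈⟨ sym (assoc (y ⁻¹) (x ⁻¹) (x' ∙ y')) ⟩
      y ⁻¹ ∙ x ⁻¹ ∙ (x' ∙ y')        ≈⟨ ∙-congʳ (sym (⁻¹-anti-homo-∙ x y)) ⟩
      (x ∙ y) ⁻¹ ∙ (x' ∙ y')         ∎) (∙-closed (normal y p) q)
      where a = x ⁻¹ ∙ x'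

    ~-⁻¹-cong : ∀ {x x'} → x ~ x' → (x ⁻¹) ~ (x' ⁻¹)
    ~-⁻¹-cong {x} {x'} p = resp (begin
      x ⁻¹ ⁻¹ ∙ n ∙ x ⁻¹                   ≈⟨ ∙-congʳ (∙-congˡ (⁻¹-anti-homo-∙ (x ⁻¹) x')) ⟩
      x ⁻¹ ⁻¹ ∙ (x' ⁻¹ ∙ x ⁻¹ ⁻¹) ∙ x ⁻¹   ≈⟨ assoc (x ⁻¹ ⁻¹) (x' ⁻¹ ∙ x ⁻¹ ⁻¹) (x ⁻¹) ⟩
      x ⁻¹ ⁻¹ ∙ (x' ⁻¹ ∙ x ⁻¹ ⁻¹ ∙ x ⁻¹)   ≈⟨ ∙-congˡ (assoc (x' ⁻¹) (x ⁻¹ ⁻¹) (x ⁻¹)) ⟩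
      x ⁻¹ ⁻¹ ∙ (x' ⁻¹ ∙ (x ⁻¹ ⁻¹ ∙ x ⁻¹)) ≈⟨ ∙-congˡ (∙-congˡ (inverseˡ (x ⁻¹))) ⟩
      x ⁻¹ ⁻¹ ∙ (x' ⁻¹ ∙ ε)                ≈⟨ ∙-congˡ (identityʳ (x' ⁻¹)) ⟩
      x ⁻¹ ⁻¹ ∙ x' ⁻¹                      ∎) (normal (x ⁻¹) (⁻¹-closed p))
      where n = (x ⁻¹ ∙ x') ⁻¹

    ~-isEquivalence : IsEquivalence _~_
    ~-isEquivalence = record
      { refl  = lift refl
      ; sym   = ~-sym
      ; trans = ~-trans
      }

    quotientIsGroup : IsGroup _~_ _∙_ ε _⁻¹
    quotientIsGroup = record
      { isMonoid = record
        { isSemigroup = record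
          { isMagma = record
            { isEquivalence = ~-isEquivalence
            ; ∙-cong = ~-∙-cong
            }
          ; assoc = λ x y z → lift (assoc x y z)
          }
        ; identity = (λ x → lift (identityˡ x)) , (λ x → lift (identityʳ x))
        }
      ; inverse = (λ x → lift (inverseˡ x)) , (λ x → lift (inverseʳ x))
      ; ⁻¹-cong = ~-⁻¹-cong
      }

  quotientGroup : Group c ℓN
  quotientGroup = record
    { Carrier = Carrier
    ; _≈_     = _~_
    ; _∙_     = _∙_
    ; ε       = ε
    ; _⁻¹     = _⁻¹
    ; isGroup = quotientIsGroup
    }

  φ : Carrier → Group.Carrier quotientGroup
  φ x = x

  imageφ : Pred Carrier ℓL → Pred (Group.Carrier quotientGroup) (c ⊔ ℓN ⊔ ℓL)
  imageφ S y = ∃ λ s → S s × (y ~ φ s)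

module _ (G : Group c ℓ) where
  open Group G

  Arc2S : Pred Carrier ℓL → Pred Carrier ℓR → Carrier → Carrier → Set (c ⊔ ℓ ⊔ ℓL ⊔ ℓR)
  Arc2S L R g h = ∃₂ λ l r → L l × R r × (h ≈ l ⁻¹ ∙ g ∙ r)

  data WConn (L : Pred Carrier ℓL) (R : Pred Carrier ℓR)
       : Carrier → Carrier → Set (c ⊔ ℓ ⊔ ℓL ⊔ ℓR) where
    here : ∀ {g h} → g ≈ h → WConn L R g h
    fwd  : ∀ {g k h} → Arc2S L R g k → WConn L R k h → WConn L R g h
    bwd  : ∀ {g k h} → Arc2S L R k g → WConn L R k h → WConn L R g h

  WeaklyConnected : Pred Carrier ℓL → Pred Carrier ℓR → Set (c ⊔ ℓ ⊔ ℓL ⊔ ℓR)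
  WeaklyConnected L R = ∀ g h → WConn L R g h

  WeaklyConnectedWithin : Pred Carrier ℓL → Pred Carrier ℓR → Pred Carrier ℓH
                          → Set (c ⊔ ℓ ⊔ ℓL ⊔ ℓR ⊔ ℓH)
  WeaklyConnectedWithin L R H = ∀ g h → H g → H h → WConn L R g h

module Submission where

-- The key observation is that walks in 2S(G;L,R) are translation
-- invariant: each arc g → l⁻¹ g r multiplies on the left by l⁻¹ and on
-- the right by r, independently of g.  Hence a walk from g to g'
-- yields a, b with g' = a g b such that EVERY vertex z is weakly
-- connected to a z b (the same steps applied to z).
--
-- (⇒) Walks in G project along φ to walks in G/N, and N is trivially
--     weakly connected within a weakly connected digraph.
-- (⇐) It suffices to connect ε to an arbitrary h.  A walk ε ⇝ φ(h) in
--     G/N lifts to a walk ε ⇝ y in G with y⁻¹ h ∈ N; write y = a ε b as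
--     above.  Then n = b (y⁻¹ h) b⁻¹ lies in N, so ε ⇝ n inside N's
--     weak connectivity, and n ⇝ a n b = h by translation invariance.

open import Defs
open import Level using (Level; _⊔_)
open import Algebra.Bundles using (Group)
open import Data.Product using (_×_; ∃; ∃₂; _,_)
open import Relation.Unary using (Pred)
open import Function.Bundles using (_⇔_; mk⇔)
import Algebra.Properties.Group as GroupProperties
import Algebra.Properties.Monoid as MonoidProperties
import Relation.Binary.Reasoning.Setoid as SetoidReasoning

module GroupAlgebra {c ℓ} (H : Group c ℓ) where
  open Group H
  open SetoidReasoning setoid

  regroup : ∀ a u g v b → a ∙ (u ∙ g ∙ v) ∙ b ≈ (a ∙ u) ∙ g ∙ (v ∙ b)
  regroup a u g v b = begin
    a ∙ (u ∙ g ∙ v) ∙ b     ≈⟨ ∙-congʳ (sym (assoc a (u ∙ g) v)) ⟩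
    a ∙ (u ∙ g) ∙ v ∙ b     ≈⟨ ∙-congʳ (∙-congʳ (sym (assoc a u g))) ⟩
    a ∙ u ∙ g ∙ v ∙ b       ≈⟨ assoc (a ∙ u ∙ g) v b ⟩
    (a ∙ u) ∙ g ∙ (v ∙ b)   ∎

  cancel-sides : ∀ {u v w t} k → u ∙ v ≈ ε → w ∙ t ≈ ε → u ∙ (v ∙ k ∙ w) ∙ t ≈ k
  cancel-sides {u} {v} {w} {t} k uv≈ε wt≈ε = begin
    u ∙ (v ∙ k ∙ w) ∙ t    ≈⟨ regroup u v k w t ⟩
    (u ∙ v) ∙ k ∙ (w ∙ t)  ≈⟨ ∙-cong (∙-congʳ uv≈ε) wt≈ε ⟩
    ε ∙ k ∙ ε              ≈⟨ identityʳ (ε ∙ k) ⟩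
    ε ∙ k                  ≈⟨ identityˡ k ⟩
    k                      ∎

  unstep : ∀ a x b → x ≈ a ⁻¹ ∙ (a ∙ x ∙ b ⁻¹) ∙ b
  unstep a x b = sym (cancel-sides x (inverseˡ a) (inverseˡ b))

  solve-source : ∀ {g k} u v → g ≈ u ⁻¹ ∙ k ∙ v → k ≈ u ∙ g ∙ v ⁻¹
  solve-source {g} {k} u v g≈ukv = begin
    k                          ≈⟨ cancel-sides k (inverseʳ u) (inverseʳ v) ⟨
    u ∙ (u ⁻¹ ∙ k ∙ v) ∙ v ⁻¹  ≈⟨ ∙-congʳ (∙-congˡ g≈ukv) ⟨
    u ∙ g ∙ v ⁻¹               ∎

  trivial-translation : ∀ z → z ≈ ε ∙ z ∙ ε
  trivial-translation z = sym (trans (identityʳ (ε ∙ z)) (identityˡ z))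

  translate-conjugate : ∀ a b m → a ∙ (b ∙ m ∙ b ⁻¹) ∙ b ≈ (a ∙ b) ∙ m
  translate-conjugate a b m = begin
    a ∙ (b ∙ m ∙ b ⁻¹) ∙ b    ≈⟨ regroup a b m (b ⁻¹) b ⟩
    (a ∙ b) ∙ m ∙ (b ⁻¹ ∙ b)  ≈⟨ ∙-congˡ (inverseˡ b) ⟩
    (a ∙ b) ∙ m ∙ ε           ≈⟨ identityʳ _ ⟩
    (a ∙ b) ∙ m               ∎

module Walks {c ℓ ℓL ℓR} (H : Group c ℓ) (L : Pred (Group.Carrier H) ℓL)
             (R : Pred (Group.Carrier H) ℓR) where
  open Group H
  open GroupAlgebra H

  _⇝_ : Carrier → Carrier → Set (c ⊔ ℓ ⊔ ℓL ⊔ ℓR)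
  _⇝_ = WConn H L R

  ⇝-respˡ : ∀ {g g' h} → g ≈ g' → g' ⇝ h → g ⇝ h
  ⇝-respˡ e (here p) = here (trans e p)
  ⇝-respˡ e (fwd (l , r , Ll , Rr , q) p) =
    fwd (l , r , Ll , Rr , trans q (∙-congʳ (∙-congˡ (sym e)))) p
  ⇝-respˡ e (bwd (l , r , Ll , Rr , q) p) =
    bwd (l , r , Ll , Rr , trans e q) p

  ⇝-trans : ∀ {g k h} → g ⇝ k → k ⇝ h → g ⇝ h
  ⇝-trans (here e)  q = ⇝-respˡ e q
  ⇝-trans (fwd a p) q = fwd a (⇝-trans p q)
  ⇝-trans (bwd a p) q = bwd a (⇝-trans p q)

  ⇝-respʳ : ∀ {g h h'} → g ⇝ h → h ≈ h' → g ⇝ h'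
  ⇝-respʳ p e = ⇝-trans p (here e)

  ⇝-sym : ∀ {g h} → g ⇝ h → h ⇝ g
  ⇝-sym (here e)  = here (sym e)
  ⇝-sym (fwd a p) = ⇝-trans (⇝-sym p) (bwd a (here refl))
  ⇝-sym (bwd a p) = ⇝-trans (⇝-sym p) (fwd a (here refl))

  Translation : Carrier → Carrier → Set (c ⊔ ℓ ⊔ ℓL ⊔ ℓR)
  Translation a b = ∀ z → z ⇝ (a ∙ z ∙ b)

  identity-translation : Translation ε ε
  identity-translation z = here (trivial-translation z)

  translation-fwd : ∀ {a b l r} → L l → R r →
                    Translation a b → Translation (a ∙ l ⁻¹) (r ∙ b)
  translation-fwd {a} {b} {l} {r} Ll Rr T z =
    fwd (l , r , Ll , Rr , refl) (⇝-respʳ (T (l ⁻¹ ∙ z ∙ r)) (regroup a (l ⁻¹) z r b))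

  translation-bwd : ∀ {a b l r} → L l → R r →
                    Translation a b → Translation (a ∙ l) (r ⁻¹ ∙ b)
  translation-bwd {a} {b} {l} {r} Ll Rr T z =
    bwd (l , r , Ll , Rr , unstep l z r) (⇝-respʳ (T (l ∙ z ∙ r ⁻¹)) (regroup a l z (r ⁻¹) b))

  walk-translation : ∀ {g g'} → g ⇝ g' →
                     ∃₂ λ a b → g' ≈ a ∙ g ∙ b × Translation a b
  walk-translation {g} (here g≈g') =
    ε , ε , trans (sym g≈g') (trivial-translation g) , identity-translation
  walk-translation {g} (fwd (l , r , Ll , Rr , k≈lgr) p) with walk-translation p
  ... | a , b , g'≈akb , T =
    a ∙ l ⁻¹ , r ∙ b ,
    trans g'≈akb (trans (∙-congʳ (∙-congˡ k≈lgr)) (regroup a (l ⁻¹) g r b)) ,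
    translation-fwd Ll Rr T
  walk-translation {g} (bwd (l , r , Ll , Rr , g≈lkr) p) with walk-translation p
  ... | a , b , g'≈akb , T =
    a ∙ l , r ⁻¹ ∙ b ,
    trans g'≈akb (trans (∙-congʳ (∙-congˡ (solve-source l r g≈lkr))) (regroup a l g (r ⁻¹) b)) ,
    translation-bwd Ll Rr T

module Projection {c ℓ ℓN ℓL ℓR} (G : Group c ℓ) (L : Pred (Group.Carrier G) ℓL)
                  (R : Pred (Group.Carrier G) ℓR) {N : Pred (Group.Carrier G) ℓN}
                  (isN : IsNormalSubgroup G N) where
  open Group G
  open IsNormalSubgroup isN
  private
    Q = quotientGroup G isN
    module Q = Group Q
    L' = imageφ G isN L
    R' = imageφ G isN R
  open Walks G L R
  open Walks Q L' R' using () renaming (_⇝_ to _⇝Q_)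

  ≈⇒~ : ∀ {x y} → x ≈ y → x Q.≈ y
  ≈⇒~ {x} x≈y = resp (trans (sym (inverseˡ x)) (∙-congˡ x≈y)) ε∈

  project : ∀ {x y} → x ⇝ y → x ⇝Q y
  project (here e) = here (≈⇒~ e)
  project (fwd (l , r , Ll , Rr , e) p) =
    fwd (l , r , (l , Ll , Q.refl) , (r , Rr , Q.refl) , ≈⇒~ e) (project p)
  project (bwd (l , r , Ll , Rr , e) p) =
    bwd (l , r , (l , Ll , Q.refl) , (r , Rr , Q.refl) , ≈⇒~ e) (project p)

  lift : ∀ {x y} → x ⇝Q y → ∀ x₀ → x₀ Q.≈ x → ∃ λ y₀ → x₀ ⇝ y₀ × y₀ Q.≈ y
  lift (here e) x₀ x₀~x = x₀ , here refl , Q.trans x₀~x e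
  lift (fwd (l' , r' , (l , Ll , l'~l) , (r , Rr , r'~r) , e) p) x₀ x₀~x
    with lift p (l ⁻¹ ∙ x₀ ∙ r)
           (Q.trans (Q.∙-cong (Q.∙-cong (Q.⁻¹-cong (Q.sym l'~l)) x₀~x) (Q.sym r'~r)) (Q.sym e))
  ... | y₀ , q , y₀~y = y₀ , fwd (l , r , Ll , Rr , refl) q , y₀~y
  lift (bwd (l' , r' , (l , Ll , l'~l) , (r , Rr , r'~r) , e) p) x₀ x₀~x
    with lift p (l ∙ x₀ ∙ r ⁻¹)
           (Q.trans (Q.∙-cong (Q.∙-cong (Q.sym l'~l) x₀~x) (Q.⁻¹-cong (Q.sym r'~r)))
                    (Q.sym (GroupAlgebra.solve-source Q l' r' e)))
  ... | y₀ , q , y₀~y = y₀ , bwd (l , r , Ll , Rr , GroupAlgebra.unstep G l x₀ r) q , y₀~y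

  connected-from-ε : WeaklyConnected Q L' R' → WeaklyConnectedWithin G L R N →
                     ∀ h → ε ⇝ h
  connected-from-ε wcQ wcN h with lift (wcQ ε h) ε Q.refl
  ... | y , ε⇝y , y~h with walk-translation ε⇝y
  ... | a , b , y≈aεb , T = ⇝-trans (wcN ε n ε∈ n∈N) (⇝-respʳ (T n) anb≈h)
    where
    open SetoidReasoning setoid
    open MonoidProperties monoid using (cancelˡ)
    n = b ∙ (y ⁻¹ ∙ h) ∙ b ⁻¹

    n∈N : N n
    n∈N = resp (∙-congʳ (∙-congʳ (GroupProperties.⁻¹-involutive G b))) (normal (b ⁻¹) y~h)

    anb≈h : a ∙ n ∙ b ≈ h
    anb≈h = begin
      a ∙ n ∙ b            ≈⟨ GroupAlgebra.translate-conjugate G a b (y ⁻¹ ∙ h) ⟩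
      (a ∙ b) ∙ (y ⁻¹ ∙ h)  ≈⟨ ∙-congʳ (trans y≈aεb (∙-congʳ (identityʳ a))) ⟨
      y ∙ (y ⁻¹ ∙ h)        ≈⟨ cancelˡ (inverseʳ y) h ⟩
      h                     ∎

-- Corollary 6.3.
corollary6p3 : ∀ {c ℓ ℓN ℓL ℓR : Level}
    (G : Group c ℓ) (L : Pred (Group.Carrier G) ℓL) (R : Pred (Group.Carrier G) ℓR)
    (N : Pred (Group.Carrier G) ℓN) (isN : IsNormalSubgroup G N) →
    ∃ L → ∃ R →
    WeaklyConnected G L R ⇔
    (WeaklyConnected (quotientGroup G isN) (imageφ G isN L) (imageφ G isN R)
    × WeaklyConnectedWithin G L R N)
corollary6p3 G L R N isN _ _ = mk⇔ to from
  where
  open Walks G L R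
  open Projection G L R isN

  to : WeaklyConnected G L R →
       WeaklyConnected (quotientGroup G isN) (imageφ G isN L) (imageφ G isN R)
       × WeaklyConnectedWithin G L R N
  to wc = (λ g h → project (wc g h)) , (λ g h _ _ → wc g h)

  from : WeaklyConnected (quotientGroup G isN) (imageφ G isN L) (imageφ G isN R)
         × WeaklyConnectedWithin G L R N → WeaklyConnected G L R
  from (wcQ , wcN) g h =
    ⇝-trans (⇝-sym (connected-from-ε wcQ wcN g)) (connected-from-ε wcQ wcN h)
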